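{- For any non-empty finite simple graphs $G$ and $H$, $\gamma_R(G\boxtimes H)\le \gamma_R(G)\gamma_R(H)-2$.
   Context: A graph is non-empty if it has at least one edge. A Roman dominating function on a graph $X$ is a map $f:V(X)\to\{0,1,2\}$ such that every vertex $v$ with $f(v)=0$ has a neighbor $u$ with $f(u)=2$; $\gamma_R(X)$ is the minimum of $\sum_v f(v)$ over such $f$. The strong product $G\boxtimes H$ has vertex set $V(G)\times V(H)$, with distinct $(g,h),(g',h')$ adjacent iff ($g=g'$ and $h\sim h'$) or ($g\sim g'$ and $h=h'$) or ($g\sim g'$ and $h\sim h'$). -}

module Defs where

open import Data.Nat using (ℕ; _+_; _*_; _≤_)
open import Data.Fin using (Fin)
import Data.Fin as Fin
import Data.Nat as ℕ
open import Data.Fin.Properties using (_≟_)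
open import Data.Product using (Σ; ∃; ∃-syntax; _×_; _,_)
open import Data.Sum using (_⊎_)
open import Data.Bool using (Bool; true; false; _∧_; _∨_; if_then_else_)
open import Relation.Binary.PropositionalEquality using (_≡_; refl; cong; cong₂; sym)
open import Relation.Nullary using (¬_; yes; no)
open import Data.Empty using (⊥-elim)
open import Relation.Nullary.Decidable using (⌊_⌋)

record Graph : Set where
  field
    n      : ℕ
    adj    : Fin n → Fin n → Bool
    adj-sym : ∀ u v → adj u v ≡ adj v u
    irrefl : ∀ v → adj v v ≡ false

open Graph public

Vertex : Graph → Set
Vertex G = Fin (n G)

Adj : (G : Graph) → Vertex G → Vertex G → Set
Adj G u v = adj G u v ≡ true

NonEmpty : Graph → Set
NonEmpty G = ∃[ u ] ∃[ v ] Adj G u v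

data RVal : Set where
  r0 r1 r2 : RVal

rval : RVal → ℕ
rval r0 = 0
rval r1 = 1
rval r2 = 2

sumFin : (m : ℕ) → (Fin m → ℕ) → ℕ
sumFin ℕ.zero    f = 0
sumFin (ℕ.suc m) f = f Fin.zero + sumFin m (λ i → f (Fin.suc i))

weight : (G : Graph) → (Vertex G → RVal) → ℕ
weight G f = sumFin (n G) (λ v → rval (f v))

IsRDF : (G : Graph) → (Vertex G → RVal) → Set
IsRDF G f = ∀ v → f v ≡ r0 → ∃[ u ] (Adj G v u × f u ≡ r2)

IsRomanDomNumber : Graph → ℕ → Set
IsRomanDomNumber G k =
  (∃[ f ] (IsRDF G f × weight G f ≡ k)) ×
  (∀ f → IsRDF G f → k ≤ weight G f)

open import Data.Fin using (combine; remQuot)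
open import Data.Fin.Properties using (remQuot-combine)

strongAdj : (G H : Graph) → Vertex G × Vertex H → Vertex G × Vertex H → Bool
strongAdj G H (g , h) (g' , h') =
  (⌊ g ≟ g' ⌋ ∧ adj H h h') ∨ (adj G g g' ∧ ⌊ h ≟ h' ⌋) ∨ (adj G g g' ∧ adj H h h')

private
  ≟-sym : ∀ {m} (a b : Fin m) → ⌊ a ≟ b ⌋ ≡ ⌊ b ≟ a ⌋
  ≟-sym a b with a ≟ b | b ≟ a
  ... | yes _ | yes _ = refl
  ... | no _  | no _  = refl
  ... | yes p | no q  = ⊥-elim (q (sym p))
  ... | no p  | yes q = ⊥-elim (p (sym q))

  ≟-refl : ∀ {m} (a : Fin m) → ⌊ a ≟ a ⌋ ≡ true
  ≟-refl a with a ≟ a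
  ... | yes _ = refl
  ... | no p  = ⊥-elim (p refl)

strongAdj-sym : (G H : Graph) → ∀ p q → strongAdj G H p q ≡ strongAdj G H q p
strongAdj-sym G H (g , h) (g' , h')
  rewrite ≟-sym g g' | ≟-sym h h' | adj-sym G g g' | adj-sym H h h' = refl

strongAdj-irrefl : (G H : Graph) → ∀ p → strongAdj G H p p ≡ false
strongAdj-irrefl G H (g , h) rewrite ≟-refl g | ≟-refl h | irrefl G g | irrefl H h = refl

-- Strong product G ⊠ H; the vertex (g , h) is encoded as combine g h : Fin (n G * n H)
_⊠_ : Graph → Graph → Graph
G ⊠ H = record
  { n       = n G * n H
  ; adj     = λ u v → strongAdj G H (remQuot (n H) u) (remQuot (n H) v)
  ; adj-sym = λ u v → strongAdj-sym G H (remQuot (n H) u) (remQuot (n H) v)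
  ; irrefl  = λ v → strongAdj-irrefl G H (remQuot (n H) v)
  }

-- Take minimum Roman dominating functions f and g of G and H. Along an edge
-- u ~ v with f u = f v = 1 the unit of v can be moved onto u, so both may be
-- assumed to take the value 2 somewhere. The function (x , y) ↦ min 2 (f x · g y)
-- is Roman dominating on G ⊠ H: a zero there comes from a zero in a coordinate,
-- dominated along an edge of that factor (diagonally if both coordinates are
-- zero). Its weight is at most Σ f x · g y = γ_R(G) γ_R(H), and at a pair of
-- 2s it is 2 instead of 4.
module Submission where

open import Defs
open import Data.Nat using (ℕ; _+_; _*_; _≤_)
open import Data.Nat.Properties
  using (+-*-semiring; +-commutativeSemigroup; +-comm; +-assoc; +-identityʳ; +-cancelʳ-≡;
         m≤m+n; +-monoʳ-≤; +-monoˡ-≤; module ≤-Reasoning)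
open import Data.Fin using (Fin; zero; suc; combine; remQuot; _↑ˡ_; _↑ʳ_; punchIn)
open import Data.Fin.Properties using (_≟_; punchInᵢ≢i; remQuot-combine)
open import Data.Vec.Functional using (updateAt)
open import Data.Vec.Functional.Properties using (updateAt-updates; updateAt-minimal)
open import Data.Product using (∃-syntax; _×_; _,_; proj₁; proj₂; uncurry)
open import Data.Bool using (true; _∧_; _∨_)
open import Data.Bool.Properties using (∨-zeroʳ)
open import Function using (_∘_; const)
open import Relation.Binary.PropositionalEquality
open import Relation.Nullary using (yes; no)
open import Relation.Nullary.Decidable using (⌊_⌋; dec-yes-recompute)
open import Algebra.Properties.Semiring.Sum +-*-semiring
  using (sum; sum-syntax; sum-cong-≗; sum-remove; ∑-distrib-+; *-distribˡ-sum; *-distribʳ-sum)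
open import Algebra.Properties.CommutativeSemigroup +-commutativeSemigroup using (x∙yz≈y∙xz)

sumFin≡sum : ∀ m (h : Fin m → ℕ) → sumFin m h ≡ sum h
sumFin≡sum ℕ.zero    h = refl
sumFin≡sum (ℕ.suc m) h = cong (h zero +_) (sumFin≡sum m (h ∘ suc))

term≤sum : ∀ {m} (h : Fin m → ℕ) i → h i ≤ sum h
term≤sum {ℕ.suc _} h i = subst (h i ≤_) (sym (sum-remove {i = i} h)) (m≤m+n _ _)

sum-≗-except : ∀ {m} {h h′ : Fin m → ℕ} i → (∀ j → j ≢ i → h j ≡ h′ j) →
               h i + sum h′ ≡ h′ i + sum h
sum-≗-except {ℕ.suc _} {h} {h′} i agree = begin
  h i + sum h′                        ≡⟨ cong (h i +_) (sum-remove h′) ⟩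
  h i + (h′ i + sum (h′ ∘ punchIn i)) ≡⟨ x∙yz≈y∙xz (h i) (h′ i) _ ⟩
  h′ i + (h i + sum (h′ ∘ punchIn i)) ≡⟨ cong (λ s → h′ i + (h i + s)) (sum-cong-≗ agree∘punchIn) ⟨
  h′ i + (h i + sum (h ∘ punchIn i))  ≡⟨ cong (h′ i +_) (sum-remove h) ⟨
  h′ i + sum h                        ∎
  where
  open ≡-Reasoning
  agree∘punchIn : ∀ j → h (punchIn i j) ≡ h′ (punchIn i j)
  agree∘punchIn j = agree (punchIn i j) (punchInᵢ≢i i j)

sum-↑ : ∀ k {m} (h : Fin (k + m) → ℕ) →
        sum h ≡ ∑[ i < k ] h (i ↑ˡ m) + ∑[ j < m ] h (k ↑ʳ j)
sum-↑ ℕ.zero    h = refl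
sum-↑ (ℕ.suc k) h = trans (cong (h zero +_) (sum-↑ k (h ∘ suc))) (sym (+-assoc (h zero) _ _))

sum-combine : ∀ m {k} (h : Fin (m * k) → ℕ) → sum h ≡ ∑[ i < m ] ∑[ j < k ] h (combine i j)
sum-combine ℕ.zero    h = refl
sum-combine (ℕ.suc m) {k} h =
  trans (sum-↑ k h) (cong (∑[ j < k ] h (j ↑ˡ (m * k)) +_) (sum-combine m (h ∘ (k ↑ʳ_))))

∑∑-* : ∀ {m k} (x : Fin m → ℕ) (y : Fin k → ℕ) → ∑[ i < m ] ∑[ j < k ] (x i * y j) ≡ sum x * sum y
∑∑-* x y = trans (sum-cong-≗ (λ i → sym (*-distribˡ-sum (x i) y))) (sym (*-distribʳ-sum (sum y) x))

weight≡sum : (G : Graph) (f : Vertex G → RVal) → weight G f ≡ sum (rval ∘ f)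
weight≡sum G f = sumFin≡sum (n G) (rval ∘ f)

weight-updateAt : (G : Graph) (f : Vertex G → RVal) (u : Vertex G) (r : RVal) →
                  weight G (updateAt f u (const r)) + rval (f u) ≡ weight G f + rval r
weight-updateAt G f u r = begin
  weight G f′ + rval (f u)          ≡⟨ +-comm (weight G f′) _ ⟩
  rval (f u) + weight G f′          ≡⟨ cong (rval (f u) +_) (weight≡sum G f′) ⟩
  rval (f u) + sum (rval ∘ f′)      ≡⟨ sum-≗-except u (λ x x≢u → cong rval (sym (updateAt-minimal x u f x≢u))) ⟩
  rval (f′ u) + sum (rval ∘ f)      ≡⟨ cong₂ _+_ (cong rval (updateAt-updates u f)) (sym (weight≡sum G f)) ⟩
  rval r + weight G f               ≡⟨ +-comm (rval r) _ ⟩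
  weight G f + rval r               ∎
  where
  open ≡-Reasoning
  f′ : Vertex G → RVal
  f′ = updateAt f u (const r)

Adj⇒≢ : (G : Graph) {u v : Vertex G} → Adj G u v → u ≢ v
Adj⇒≢ G {u} e refl with trans (sym e) (irrefl G u)
... | ()

module _ (G : Graph) (f : Vertex G → RVal) {u v : Vertex G} where

  shift : Vertex G → RVal
  shift = updateAt (updateAt f v (const r0)) u (const r2)

  shift-off : ∀ {x} → x ≢ u → x ≢ v → shift x ≡ f x
  shift-off x≢u x≢v = trans (updateAt-minimal _ u _ x≢u) (updateAt-minimal _ v f x≢v)

  IsRDF-shift : Adj G u v → f v ≡ r1 → IsRDF G f → IsRDF G shift
  IsRDF-shift e fv rf x shiftx≡r0 with x ≟ u
  ... | yes refl with () ← trans (sym (updateAt-updates u _)) shiftx≡r0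
  ... | no x≢u with x ≟ v
  ...   | yes refl = u , trans (adj-sym G v u) e , updateAt-updates u _
  ...   | no x≢v with rf x (trans (sym (shift-off x≢u x≢v)) shiftx≡r0)
  ...     | w , x~w , fw with w ≟ u
  ...       | yes refl = w , x~w , updateAt-updates u _
  ...       | no w≢u = w , x~w , trans (shift-off w≢u w≢v) fw
    where
    w≢v : w ≢ v
    w≢v refl with () ← trans (sym fv) fw

  weight-shift : u ≢ v → f u ≡ r1 → f v ≡ r1 → weight G shift ≡ weight G f
  weight-shift u≢v fu fv = +-cancelʳ-≡ 1 _ _ (begin
    weight G shift + 1             ≡⟨ cong (λ r → weight G shift + rval r) (sym f₀u≡r1) ⟩
    weight G shift + rval (f₀ u)   ≡⟨ weight-updateAt G f₀ u r2 ⟩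
    weight G f₀ + 2                ≡⟨ +-assoc (weight G f₀) 1 1 ⟨
    weight G f₀ + 1 + 1            ≡⟨ cong (λ r → weight G f₀ + rval r + 1) fv ⟨
    weight G f₀ + rval (f v) + 1   ≡⟨ cong (_+ 1) (weight-updateAt G f v r0) ⟩
    weight G f + 0 + 1             ≡⟨ cong (_+ 1) (+-identityʳ (weight G f)) ⟩
    weight G f + 1                 ∎)
    where
    open ≡-Reasoning
    f₀ : Vertex G → RVal
    f₀ = updateAt f v (const r0)
    f₀u≡r1 : f₀ u ≡ r1
    f₀u≡r1 = trans (updateAt-minimal u v f u≢v) fu

IsRDF-with-r2 : (G : Graph) → NonEmpty G → (f : Vertex G → RVal) → IsRDF G f →
  ∃[ f′ ] (IsRDF G f′ × weight G f′ ≡ weight G f × ∃[ x ] f′ x ≡ r2)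
IsRDF-with-r2 G (u , v , e) f rf with f u in fu | f v in fv
... | r2 | _  = f , rf , refl , u , fu
... | r0 | _  with w , _ , fw ← rf u fu = f , rf , refl , w , fw
... | r1 | r2 = f , rf , refl , v , fv
... | r1 | r0 with w , _ , fw ← rf v fv = f , rf , refl , w , fw
... | r1 | r1 = shift G f , IsRDF-shift G f e fv rf , weight-shift G f (Adj⇒≢ G e) fu fv ,
                u , updateAt-updates u _

⊠-adj-right : (G H : Graph) {x : Vertex G} {y y′ : Vertex H} →
              Adj H y y′ → strongAdj G H (x , y) (x , y′) ≡ true
⊠-adj-right G H {x} e rewrite dec-yes-recompute (x ≟ x) refl | e = refl

⊠-adj-left : (G H : Graph) {x x′ : Vertex G} {y : Vertex H} →
             Adj G x x′ → strongAdj G H (x , y) (x′ , y) ≡ true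
⊠-adj-left G H {y = y} e rewrite e | dec-yes-recompute (y ≟ y) refl = ∨-zeroʳ _

⊠-adj-diag : (G H : Graph) {x x′ : Vertex G} {y y′ : Vertex H} →
             Adj G x x′ → Adj H y y′ → strongAdj G H (x , y) (x′ , y′) ≡ true
⊠-adj-diag G H {x} {x′} {y} {y′} e e′ rewrite e | e′ =
  trans (cong (⌊ x ≟ x′ ⌋ ∧ true ∨_) (∨-zeroʳ ⌊ y ≟ y′ ⌋)) (∨-zeroʳ _)

-- min 2 (x · y), together with the amount it falls short of x · y
_⊗_ : RVal → RVal → RVal
r0 ⊗ _  = r0
_  ⊗ r0 = r0
r1 ⊗ r1 = r1
_  ⊗ _  = r2

excess : RVal → RVal → ℕ
excess r2 r2 = 2
excess _  _  = 0

rval-* : ∀ x y → rval x * rval y ≡ rval (x ⊗ y) + excess x y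
rval-* r0 _  = refl
rval-* r1 r0 = refl
rval-* r1 r1 = refl
rval-* r1 r2 = refl
rval-* r2 r0 = refl
rval-* r2 r1 = refl
rval-* r2 r2 = refl

module _ (G H : Graph) (f : Vertex G → RVal) (g : Vertex H → RVal) where

  coords : Vertex (G ⊠ H) → Vertex G × Vertex H
  coords = remQuot {n G} (n H)

  prod : Vertex (G ⊠ H) → RVal
  prod p = uncurry (λ x y → f x ⊗ g y) (coords p)

  ⊗-dominated : IsRDF G f → IsRDF H g → ∀ x y → f x ⊗ g y ≡ r0 →
                ∃[ x′ ] ∃[ y′ ] (strongAdj G H (x , y) (x′ , y′) ≡ true × f x′ ⊗ g y′ ≡ r2)
  ⊗-dominated rf rg x y _ with f x in fx | g y in gy
  ... | r0 | r0 with x′ , x~x′ , fx′ ← rf x fx | y′ , y~y′ , gy′ ← rg y gy =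
    x′ , y′ , ⊠-adj-diag G H x~x′ y~y′ , cong₂ _⊗_ fx′ gy′
  ... | r0 | r1 with x′ , x~x′ , fx′ ← rf x fx = x′ , y , ⊠-adj-left G H {y = y} x~x′ , cong₂ _⊗_ fx′ gy
  ... | r0 | r2 with x′ , x~x′ , fx′ ← rf x fx = x′ , y , ⊠-adj-left G H {y = y} x~x′ , cong₂ _⊗_ fx′ gy
  ... | r1 | r0 with y′ , y~y′ , gy′ ← rg y gy = x , y′ , ⊠-adj-right G H {x} y~y′ , cong₂ _⊗_ fx gy′
  ... | r2 | r0 with y′ , y~y′ , gy′ ← rg y gy = x , y′ , ⊠-adj-right G H {x} y~y′ , cong₂ _⊗_ fx gy′
  ⊗-dominated rf rg x y () | r1 | r1
  ⊗-dominated rf rg x y () | r1 | r2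
  ⊗-dominated rf rg x y () | r2 | r1
  ⊗-dominated rf rg x y () | r2 | r2

  IsRDF-prod : IsRDF G f → IsRDF H g → IsRDF (G ⊠ H) prod
  IsRDF-prod rf rg p prodp≡r0
    with x′ , y′ , p~q , q-value ← ⊗-dominated rf rg (proj₁ (coords p)) (proj₂ (coords p)) prodp≡r0 =
    combine x′ y′ ,
    subst (λ q → strongAdj G H (coords p) q ≡ true) (sym (remQuot-combine x′ y′)) p~q ,
    subst (λ q → uncurry (λ x y → f x ⊗ g y) q ≡ r2) (sym (remQuot-combine x′ y′)) q-value

  sum-coords : (h : Vertex G × Vertex H → ℕ) → sum (h ∘ coords) ≡ ∑[ x < n G ] ∑[ y < n H ] h (x , y)
  sum-coords h = trans (sum-combine (n G) (h ∘ coords))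
    (sum-cong-≗ (λ x → sum-cong-≗ (λ y → cong h (remQuot-combine x y))))

  weight-prod : ∀ {x₀ y₀} → f x₀ ≡ r2 → g y₀ ≡ r2 → weight (G ⊠ H) prod + 2 ≤ weight G f * weight H g
  weight-prod {x₀} {y₀} fx₀ gy₀ = begin
    weight (G ⊠ H) prod + 2                    ≡⟨ cong₂ _+_ (weight≡sum (G ⊠ H) prod) excess₀ ⟩
    sum (rval ∘ prod) + loss (combine x₀ y₀)   ≤⟨ +-monoʳ-≤ (sum (rval ∘ prod)) (term≤sum loss _) ⟩
    sum (rval ∘ prod) + sum loss               ≡⟨ ∑-distrib-+ (rval ∘ prod) loss ⟨
    sum (λ p → rval (prod p) + loss p)         ≡⟨ sum-cong-≗ (λ p → sym (uncurry (λ x y → rval-* (f x) (g y)) (coords p))) ⟩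
    sum (uncurry (λ x y → rval (f x) * rval (g y)) ∘ coords)
                                               ≡⟨ sum-coords _ ⟩
    ∑[ x < n G ] ∑[ y < n H ] (rval (f x) * rval (g y))
                                               ≡⟨ ∑∑-* (rval ∘ f) (rval ∘ g) ⟩
    sum (rval ∘ f) * sum (rval ∘ g)            ≡⟨ cong₂ _*_ (weight≡sum G f) (weight≡sum H g) ⟨
    weight G f * weight H g                    ∎
    where
    open ≤-Reasoning
    loss : Vertex (G ⊠ H) → ℕ
    loss p = uncurry (λ x y → excess (f x) (g y)) (coords p)
    excess₀ : 2 ≡ loss (combine x₀ y₀)
    excess₀ = begin-equality
      2                            ≡⟨ cong₂ excess fx₀ gy₀ ⟨
      excess (f x₀) (g y₀)         ≡⟨ cong (uncurry (λ x y → excess (f x) (g y))) (remQuot-combine x₀ y₀) ⟨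
      loss (combine x₀ y₀)         ∎

corollary24 : (G H : Graph) → NonEmpty G → NonEmpty H →
    (a b c : ℕ) → IsRomanDomNumber G a → IsRomanDomNumber H b →
    IsRomanDomNumber (G ⊠ H) c → c + 2 ≤ a * b
corollary24 G H neG neH a b c ((f₀ , rf₀ , wf₀) , _) ((g₀ , rg₀ , wg₀) , _) (_ , c-minimal)
  with f , rf , wf , x₀ , fx₀ ← IsRDF-with-r2 G neG f₀ rf₀
     | g , rg , wg , y₀ , gy₀ ← IsRDF-with-r2 H neH g₀ rg₀ = begin
  c + 2                                     ≤⟨ +-monoˡ-≤ 2 (c-minimal (prod G H f g) (IsRDF-prod G H f g rf rg)) ⟩
  weight (G ⊠ H) (prod G H f g) + 2         ≤⟨ weight-prod G H f g fx₀ gy₀ ⟩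
  weight G f * weight H g                   ≡⟨ cong₂ _*_ (trans wf wf₀) (trans wg wg₀) ⟩
  a * b                                     ∎
  where open ≤-Reasoning
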